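{- Let $x,y$ be integers with $1<x<y$, and let $a,b,c\ge 0$ be integers with $c\equiv 0$ or $1\pmod y$. If $a+b=y-1$ and $a\ge \omega(x,b)$, then the multiset $\{1^a,x^b,y^c\}$ has a standard linear realization.
   Context: For a positive integer $n$, $K_n$ is the complete graph on vertex set $\{0,\dots,n-1\}$ and the linear length of an edge $\{u,w\}$ is $|u-w|$. A multiset $M$ of positive integers of size $n-1$ has a linear realization if some Hamiltonian path in $K_n$ has multiset of linear edge lengths equal to $M$; the realization is standard if the path starts at vertex $0$. $\{x_1^{a_1},\dots\}$ denotes the multiset with $x_i$ of multiplicity $a_i$. For integers $z\ge2$ and $d\ge 0$, $\omega(z,d)$ denotes the smallest integer $a\ge0$ such that $\{1^a,z^d\}$ has a standard linear realization (this minimum exists). -}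

module Defs where

open import Data.Nat using (ℕ; zero; suc; _+_; _*_; _<_; _≤_; ∣_-_∣)
open import Data.List using (List; []; _∷_; length; upTo; replicate; _++_)
open import Data.List.Relation.Binary.Permutation.Propositional using (_↭_)
open import Data.Product using (Σ; _×_; ∃-syntax)
open import Relation.Nullary using (¬_)

-- A multiset of positive integers is represented by a list (up to permutation).
Multiset : Set
Multiset = List ℕ

-- A Hamiltonian path in K_n is a list of vertices that is a permutation of
-- [0, ..., n-1].
IsHamPath : ℕ → List ℕ → Set
IsHamPath n p = p ↭ upTo n

edgeLengths : List ℕ → List ℕ
edgeLengths []           = []
edgeLengths (u ∷ [])     = []
edgeLengths (u ∷ w ∷ p)  = ∣ u - w ∣ ∷ edgeLengths (w ∷ p)

LinearRealization : Multiset → List ℕ → Set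
LinearRealization M p = IsHamPath (suc (length M)) p × edgeLengths p ↭ M

HasLinearRealization : Multiset → Set
HasLinearRealization M = ∃[ p ] LinearRealization M p

HasStandardLinearRealization : Multiset → Set
HasStandardLinearRealization M = ∃[ p ] LinearRealization M (0 ∷ p)

M₂ : ℕ → ℕ → ℕ → Multiset
M₂ a z d = replicate a 1 ++ replicate d z

M₃ : ℕ → ℕ → ℕ → ℕ → ℕ → Multiset
M₃ a x b y c = replicate a 1 ++ replicate b x ++ replicate c y

IsOmega : ℕ → ℕ → ℕ → Set
IsOmega z d w =
  HasStandardLinearRealization (M₂ w z d) ×
  (∀ a → a < w → ¬ HasStandardLinearRealization (M₂ a z d))

{-# OPTIONS --safe #-}
-- Padding with ones: prepending the vertex 0 to a standard path shifted up by one adds one edge of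
-- length 1, so a ≥ ω(x,b) gives a standard realization P of M = {1^a, x^b} on the y = a + b + 1
-- vertices [0, y). For c = k y, replace every vertex v of P by the column v, v + y, …, v + k y,
-- traversed alternately upwards and downwards. The columns tile [0, (k+1) y), each column has k
-- edges of length y, and consecutive columns are joined at equal heights, so the joining edges keep
-- the lengths of P. For c = k y + 1, first reflect P by v ↦ y - v to a path on [1, y] starting at y,
-- apply the same construction on [1, (k+1) y], and prepend the vertex 0: one more edge of length y.
module Submission where

open import Defs
open import Data.Nat using (ℕ; _+_; _*_; _<_; _≤_)
open import Data.Sum using (_⊎_)
open import Data.Product using (∃-syntax)
open import Relation.Binary.PropositionalEquality using (_≡_)

open import Data.Nat using (zero; suc; _∸_; ∣_-_∣; s≤s; z≤n; _≤′_; ≤′-refl; ≤′-step)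
open import Data.Nat.Properties
  using (+-suc; +-comm; +-assoc; +-identityʳ; *-comm; <⇒≤; ≤⇒≤′; m<m+n; m∸n≤m; m∸[m∸n]≡n;
         m≤n⇒∣n-m∣≡n∸m; ∣n-n∣≡0; ∣m-m+n∣≡n; ∣m+n-m+o∣≡∣n-o∣; ∣-∣-comm; +-commutativeSemigroup)
open import Algebra.Properties.CommutativeSemigroup +-commutativeSemigroup using (x∙yz≈yx∙z)
open import Data.List
  using (List; []; _∷_; _++_; _∷ʳ_; map; concatMap; replicate; length; upTo; applyUpTo)
open import Data.List.Properties
  using (++-assoc; length-++; length-replicate; map-upTo; map-∘; concatMap-map; concatMap-pure)
open import Data.List.Membership.Propositional using (_∈_)
open import Data.List.Relation.Unary.Any using (here; there)
open import Data.List.Relation.Unary.All using (All; []; _∷_; tabulate)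
open import Data.List.Relation.Binary.Permutation.Propositional as ↭
  using (_↭_; ↭-refl; ↭-trans; ↭-reflexive; prep; swap; module PermutationReasoning)
open import Data.List.Relation.Binary.Permutation.Propositional.Properties
  using (map⁺; ++⁺ˡ; ++⁺ʳ; ++⁺; shift; shifts; drop-∷; ∷↭∷ʳ; ↭-length; ∈-resp-↭)
open import Data.Product using (_,_; _×_)
open import Data.Sum using (inj₁; inj₂)
open import Relation.Binary.PropositionalEquality using (refl; sym; trans; cong; cong₂; subst; module ≡-Reasoning)

interval : ℕ → ℕ → List ℕ
interval s zero    = []
interval s (suc n) = s ∷ interval (suc s) n

length-interval : ∀ s n → length (interval s n) ≡ n
length-interval s zero    = refl
length-interval s (suc n) = cong suc (length-interval (suc s) n)

map-+-interval : ∀ c s n → map (c +_) (interval s n) ≡ interval (c + s) n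
map-+-interval c s zero    = refl
map-+-interval c s (suc n) =
  cong (c + s ∷_) (trans (map-+-interval c (suc s) n) (cong (λ s′ → interval s′ n) (+-suc c s)))

interval-++ : ∀ s m n → interval s (m + n) ≡ interval s m ++ interval (m + s) n
interval-++ s zero    n = refl
interval-++ s (suc m) n =
  cong (s ∷_) (trans (interval-++ (suc s) m n) (cong (λ s′ → interval (suc s) m ++ interval s′ n) (+-suc m s)))

interval-∷ʳ : ∀ s n → interval s n ∷ʳ (s + n) ≡ interval s (suc n)
interval-∷ʳ s zero    = cong (_∷ []) (+-identityʳ s)
interval-∷ʳ s (suc n) =
  cong (s ∷_) (trans (cong (interval (suc s) n ∷ʳ_) (+-suc s n)) (interval-∷ʳ (suc s) n))

upTo≡interval : ∀ n → upTo n ≡ interval 0 n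
upTo≡interval zero    = refl
upTo≡interval (suc n) = cong (0 ∷_) (begin
  applyUpTo suc n        ≡⟨ map-upTo suc n ⟨
  map suc (upTo n)       ≡⟨ cong (map suc) (upTo≡interval n) ⟩
  map suc (interval 0 n) ≡⟨ map-+-interval 1 0 n ⟩
  interval 1 n           ∎)
  where open ≡-Reasoning

∈-interval⇒< : ∀ {z} s n → z ∈ interval s n → z < s + n
∈-interval⇒< s (suc n) (here refl) = m<m+n s (s≤s z≤n)
∈-interval⇒< {z} s (suc n) (there z∈) = subst (z <_) (sym (+-suc s n)) (∈-interval⇒< (suc s) n z∈)

reflect-interval : ∀ n → map (n ∸_) (interval 0 n) ↭ interval 1 n
reflect-interval zero    = ↭-refl
reflect-interval (suc n) = begin
  suc n ∷ map (suc n ∸_) (interval 1 n)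
    ≡⟨ cong (λ I → suc n ∷ map (suc n ∸_) I) (map-+-interval 1 0 n) ⟨
  suc n ∷ map (suc n ∸_) (map suc (interval 0 n))
    ≡⟨ cong (suc n ∷_) (map-∘ (interval 0 n)) ⟨
  suc n ∷ map (n ∸_) (interval 0 n)
    ↭⟨ prep (suc n) (reflect-interval n) ⟩
  suc n ∷ interval 1 n
    ↭⟨ ∷↭∷ʳ (suc n) (interval 1 n) ⟩
  interval 1 n ∷ʳ suc n
    ≡⟨ interval-∷ʳ 1 n ⟩
  interval 1 (suc n)
    ∎
  where open PermutationReasoning

replicate-+ : ∀ {A : Set} m n (x : A) → replicate (m + n) x ≡ replicate m x ++ replicate n x
replicate-+ zero    n x = refl
replicate-+ (suc m) n x = cong (x ∷_) (replicate-+ m n x)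

replicate-shift : ∀ {A : Set} (x : A) m n xs → replicate m x ++ xs ++ replicate n x ↭ xs ++ replicate (m + n) x
replicate-shift x m n xs = ↭-trans (shifts (replicate m x) xs) (++⁺ˡ xs (↭-reflexive (sym (replicate-+ m n x))))

concatMap-↭ : ∀ {A B : Set} (f : A → List B) {xs ys} → xs ↭ ys → concatMap f xs ↭ concatMap f ys
concatMap-↭ f ↭.refl        = ↭-refl
concatMap-↭ f (prep x p)     = ++⁺ˡ (f x) (concatMap-↭ f p)
concatMap-↭ f (swap x y p)   = ↭-trans (shifts (f x) (f y)) (++⁺ˡ (f y) (++⁺ˡ (f x) (concatMap-↭ f p)))
concatMap-↭ f (↭.trans p q)  = ↭-trans (concatMap-↭ f p) (concatMap-↭ f q)

concatMap-∷ : ∀ {A : Set} (g : A → List A) xs → concatMap (λ v → v ∷ g v) xs ↭ xs ++ concatMap g xs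
concatMap-∷ g []       = ↭-refl
concatMap-∷ g (v ∷ xs) = prep v (↭-trans (++⁺ˡ (g v) (concatMap-∷ g xs)) (shifts (g v) xs))

endpoint : ℕ → List ℕ → ℕ
endpoint u []      = u
endpoint u (w ∷ p) = endpoint w p

length-edgeLengths : ∀ u p → length (edgeLengths (u ∷ p)) ≡ length p
length-edgeLengths u []      = refl
length-edgeLengths u (w ∷ p) = cong suc (length-edgeLengths w p)

edgeLengths-++ : ∀ u p q → edgeLengths (u ∷ p ++ q) ≡ edgeLengths (u ∷ p) ++ edgeLengths (endpoint u p ∷ q)
edgeLengths-++ u []      q = refl
edgeLengths-++ u (w ∷ p) q = cong (∣ u - w ∣ ∷_) (edgeLengths-++ w p q)

edgeLengths-map-+ : ∀ c p → edgeLengths (map (c +_) p) ≡ edgeLengths p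
edgeLengths-map-+ c []          = refl
edgeLengths-map-+ c (u ∷ [])    = refl
edgeLengths-map-+ c (u ∷ w ∷ p) = cong₂ _∷_ (∣m+n-m+o∣≡∣n-o∣ c u w) (edgeLengths-map-+ c (w ∷ p))

∣m+n-n∣≡m : ∀ m n → ∣ m + n - n ∣ ≡ m
∣m+n-n∣≡m m n = trans (∣-∣-comm (m + n) n) (trans (cong (∣ n -_∣) (+-comm m n)) (∣m-m+n∣≡n n m))

∣m-m∸n∣≡n : ∀ {m n} → n ≤ m → ∣ m - m ∸ n ∣ ≡ n
∣m-m∸n∣≡n {m} {n} n≤m = trans (m≤n⇒∣n-m∣≡n∸m (m∸n≤m m n)) (m∸[m∸n]≡n n≤m)

∣m∸n-m∸o∣≡∣n-o∣ : ∀ {m} n o → n ≤ m → o ≤ m → ∣ m ∸ n - m ∸ o ∣ ≡ ∣ n - o ∣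
∣m∸n-m∸o∣≡∣n-o∣ {m}     zero    zero    _         _         = ∣n-n∣≡0 m
∣m∸n-m∸o∣≡∣n-o∣         zero    (suc o) _         o≤m       = ∣m-m∸n∣≡n o≤m
∣m∸n-m∸o∣≡∣n-o∣ {m}     (suc n) zero    n≤m       _         = trans (∣-∣-comm (m ∸ suc n) m) (∣m-m∸n∣≡n n≤m)
∣m∸n-m∸o∣≡∣n-o∣ {suc m} (suc n) (suc o) (s≤s n≤m) (s≤s o≤m) = ∣m∸n-m∸o∣≡∣n-o∣ n o n≤m o≤m

edgeLengths-map-∸ : ∀ n p → All (_≤ n) p → edgeLengths (map (n ∸_) p) ≡ edgeLengths p
edgeLengths-map-∸ n []          _                  = refl
edgeLengths-map-∸ n (u ∷ [])    _                  = refl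
edgeLengths-map-∸ n (u ∷ w ∷ p) (u≤n ∷ w≤n ∷ p≤n) =
  cong₂ _∷_ (∣m∸n-m∸o∣≡∣n-o∣ u w u≤n w≤n) (edgeLengths-map-∸ n (w ∷ p) (w≤n ∷ p≤n))

RealizationOn : ℕ → ℕ → Multiset → List ℕ → Set
RealizationOn s n M P = P ↭ interval s n × edgeLengths P ↭ M

standard⇒realizationOn : ∀ {M t} → LinearRealization M (0 ∷ t) → RealizationOn 0 (suc (length M)) M (0 ∷ t)
standard⇒realizationOn {M} (vertices , lengths) =
  ↭-trans vertices (↭-reflexive (upTo≡interval (suc (length M)))) , lengths

realizationOn⇒standard : ∀ {n M t} → RealizationOn 0 n M (0 ∷ t) → HasStandardLinearRealization M
realizationOn⇒standard {n} {M} {t} (vertices , lengths) =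
  t , subst (λ m → 0 ∷ t ↭ upTo m) n≡1+|M| (↭-trans vertices (↭-reflexive (sym (upTo≡interval n))))
    , lengths
  where
  open ≡-Reasoning
  n≡1+|M| : n ≡ suc (length M)
  n≡1+|M| = begin
    n                                  ≡⟨ length-interval 0 n ⟨
    length (interval 0 n)              ≡⟨ ↭-length vertices ⟨
    suc (length t)                     ≡⟨ cong suc (length-edgeLengths 0 t) ⟨
    suc (length (edgeLengths (0 ∷ t))) ≡⟨ cong suc (↭-length lengths) ⟩
    suc (length M)                     ∎

realizationOn-resp-↭ : ∀ {s n M M′ P} → M ↭ M′ → RealizationOn s n M P → RealizationOn s n M′ P
realizationOn-resp-↭ M↭M′ (vertices , lengths) = vertices , ↭-trans lengths M↭M′

realizationOn-translate : ∀ {s n M P} c → RealizationOn s n M P → RealizationOn (c + s) n M (map (c +_) P)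
realizationOn-translate {s} {n} {M} {P} c (vertices , lengths) =
  ↭-trans (map⁺ (c +_) vertices) (↭-reflexive (map-+-interval c s n)) ,
  ↭-trans (↭-reflexive (edgeLengths-map-+ c P)) lengths

realizationOn-reflect : ∀ {n M P} → RealizationOn 0 n M P → RealizationOn 1 n M (map (n ∸_) P)
realizationOn-reflect {n} {M} {P} (vertices , lengths) =
  ↭-trans (map⁺ (n ∸_) vertices) (reflect-interval n) ,
  ↭-trans (↭-reflexive (edgeLengths-map-∸ n P P≤n)) lengths
  where
  P≤n : All (_≤ n) P
  P≤n = tabulate (λ z∈P → <⇒≤ (∈-interval⇒< 0 n (∈-resp-↭ vertices z∈P)))

realizationOn-prepend : ∀ {s n M v P} → RealizationOn (suc s) n M (v ∷ P) →
  RealizationOn s (suc n) (∣ s - v ∣ ∷ M) (s ∷ v ∷ P)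
realizationOn-prepend {s} {v = v} (vertices , lengths) = prep s vertices , prep ∣ s - v ∣ lengths

standard-1∷ : ∀ {M} → HasStandardLinearRealization M → HasStandardLinearRealization (1 ∷ M)
standard-1∷ (t , realization) =
  realizationOn⇒standard (realizationOn-prepend (realizationOn-translate 1 (standard⇒realizationOn realization)))

standard-more-ones : ∀ {a a′ M} → a ≤′ a′ →
  HasStandardLinearRealization (replicate a 1 ++ M) → HasStandardLinearRealization (replicate a′ 1 ++ M)
standard-more-ones ≤′-refl        h = h
standard-more-ones (≤′-step a≤′a′) h = standard-1∷ (standard-more-ones a≤′a′ h)

module Boustrophedon (y : ℕ) where

  rise : ℕ → ℕ → List ℕ
  rise v zero    = []
  rise v (suc k) = y + v ∷ rise (y + v) k

  fall : ℕ → ℕ → List ℕ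
  fall v zero    = []
  fall v (suc k) = k * y + v ∷ fall v k

  ascending descending : ℕ → ℕ → List ℕ
  ascending  v k = v ∷ rise v k
  descending v k = k * y + v ∷ fall v k

  edgeLengths-ascending : ∀ v k → edgeLengths (ascending v k) ≡ replicate k y
  edgeLengths-ascending v zero    = refl
  edgeLengths-ascending v (suc k) =
    cong₂ _∷_ (trans (∣-∣-comm v (y + v)) (∣m+n-n∣≡m y v)) (edgeLengths-ascending (y + v) k)

  endpoint-rise : ∀ v k → endpoint v (rise v k) ≡ k * y + v
  endpoint-rise v zero    = refl
  endpoint-rise v (suc k) = trans (endpoint-rise (y + v) k) (x∙yz≈yx∙z (k * y) y v)

  edgeLengths-descending : ∀ v k → edgeLengths (descending v k) ≡ replicate k y
  edgeLengths-descending v zero    = refl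
  edgeLengths-descending v (suc k) =
    cong₂ _∷_ (trans (cong (∣_- k * y + v ∣) (+-assoc y (k * y) v)) (∣m+n-n∣≡m y (k * y + v)))
              (edgeLengths-descending v k)

  endpoint-fall : ∀ v k → endpoint (k * y + v) (fall v k) ≡ v
  endpoint-fall v zero    = refl
  endpoint-fall v (suc k) = endpoint-fall v k

  rise-∷ʳ : ∀ v k → rise v k ∷ʳ (suc k * y + v) ≡ rise v (suc k)
  rise-∷ʳ v zero    = cong (λ z → z + v ∷ []) (+-identityʳ y)
  rise-∷ʳ v (suc k) =
    cong (y + v ∷_) (trans (cong (rise (y + v) k ∷ʳ_) (sym (x∙yz≈yx∙z (suc k * y) y v))) (rise-∷ʳ (y + v) k))

  descending↭ascending : ∀ v k → descending v k ↭ ascending v k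
  descending↭ascending v zero    = ↭-refl
  descending↭ascending v (suc k) = begin
    suc k * y + v ∷ descending v k   ↭⟨ prep _ (descending↭ascending v k) ⟩
    suc k * y + v ∷ ascending v k    ↭⟨ ∷↭∷ʳ _ (ascending v k) ⟩
    ascending v k ∷ʳ (suc k * y + v) ≡⟨ cong (v ∷_) (rise-∷ʳ v k) ⟩
    ascending v (suc k)              ∎
    where open PermutationReasoning

  columns-interval : ∀ k s → concatMap (λ v → ascending v k) (interval s y) ↭ interval s (suc k * y)
  columns-interval zero    s =
    ↭-reflexive (trans (concatMap-pure (interval s y)) (cong (interval s) (sym (+-identityʳ y))))
  columns-interval (suc k) s = begin
    concatMap (λ v → v ∷ ascending (y + v) k) (interval s y)
      ↭⟨ concatMap-∷ (λ v → ascending (y + v) k) (interval s y) ⟩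
    interval s y ++ concatMap (λ v → ascending (y + v) k) (interval s y)
      ≡⟨ cong (interval s y ++_) (concatMap-map (λ v → ascending v k) (y +_) (interval s y)) ⟨
    interval s y ++ concatMap (λ v → ascending v k) (map (y +_) (interval s y))
      ≡⟨ cong (λ I → interval s y ++ concatMap (λ v → ascending v k) I) (map-+-interval y s y) ⟩
    interval s y ++ concatMap (λ v → ascending v k) (interval (y + s) y)
      ↭⟨ ++⁺ˡ (interval s y) (columns-interval k (y + s)) ⟩
    interval s y ++ interval (y + s) (suc k * y)
      ≡⟨ interval-++ s y (suc k * y) ⟨
    interval s (suc (suc k) * y)
      ∎
    where open PermutationReasoning

  mutual
    snakeUp : ℕ → List ℕ → List ℕ
    snakeUp k []      = []
    snakeUp k (v ∷ L) = ascending v k ++ snakeDown k L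

    snakeDown : ℕ → List ℕ → List ℕ
    snakeDown k []      = []
    snakeDown k (v ∷ L) = descending v k ++ snakeUp k L

  mutual
    snakeUp↭columns : ∀ k L → snakeUp k L ↭ concatMap (λ v → ascending v k) L
    snakeUp↭columns k []      = ↭-refl
    snakeUp↭columns k (v ∷ L) = ++⁺ˡ (ascending v k) (snakeDown↭columns k L)

    snakeDown↭columns : ∀ k L → snakeDown k L ↭ concatMap (λ v → ascending v k) L
    snakeDown↭columns k []      = ↭-refl
    snakeDown↭columns k (v ∷ L) = ++⁺ (descending↭ascending v k) (snakeUp↭columns k L)

  -- The walk continues from the bottom (snakeUp) or the top (snakeDown) of the column over u.
  mutual
    edgeLengths-snakeUp : ∀ k u L →
      edgeLengths (u ∷ snakeUp k L) ↭ edgeLengths (u ∷ L) ++ replicate (length L * k) y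
    edgeLengths-snakeUp k u []      = ↭-refl
    edgeLengths-snakeUp k u (v ∷ L) = begin
      edgeLengths (u ∷ ascending v k ++ snakeDown k L)
        ≡⟨ edgeLengths-++ u (ascending v k) (snakeDown k L) ⟩
      ∣ u - v ∣ ∷ edgeLengths (ascending v k) ++ edgeLengths (endpoint v (rise v k) ∷ snakeDown k L)
        ≡⟨ cong₂ (λ A e → ∣ u - v ∣ ∷ A ++ edgeLengths (e ∷ snakeDown k L))
                 (edgeLengths-ascending v k) (endpoint-rise v k) ⟩
      ∣ u - v ∣ ∷ replicate k y ++ edgeLengths (k * y + v ∷ snakeDown k L)
        ↭⟨ prep _ (++⁺ˡ (replicate k y) (edgeLengths-snakeDown k v L)) ⟩
      ∣ u - v ∣ ∷ replicate k y ++ edgeLengths (v ∷ L) ++ replicate (length L * k) y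
        ↭⟨ prep _ (replicate-shift y k (length L * k) (edgeLengths (v ∷ L))) ⟩
      ∣ u - v ∣ ∷ edgeLengths (v ∷ L) ++ replicate (k + length L * k) y
        ∎
      where open PermutationReasoning

    edgeLengths-snakeDown : ∀ k u L →
      edgeLengths (k * y + u ∷ snakeDown k L) ↭ edgeLengths (u ∷ L) ++ replicate (length L * k) y
    edgeLengths-snakeDown k u []      = ↭-refl
    edgeLengths-snakeDown k u (v ∷ L) = begin
      edgeLengths (k * y + u ∷ descending v k ++ snakeUp k L)
        ≡⟨ edgeLengths-++ (k * y + u) (descending v k) (snakeUp k L) ⟩
      ∣ k * y + u - k * y + v ∣ ∷ edgeLengths (descending v k)
        ++ edgeLengths (endpoint (k * y + v) (fall v k) ∷ snakeUp k L)
        ≡⟨ cong₂ (λ A e → ∣ k * y + u - k * y + v ∣ ∷ A ++ edgeLengths (e ∷ snakeUp k L))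
                 (edgeLengths-descending v k) (endpoint-fall v k) ⟩
      ∣ k * y + u - k * y + v ∣ ∷ replicate k y ++ edgeLengths (v ∷ snakeUp k L)
        ≡⟨ cong (λ d → d ∷ replicate k y ++ edgeLengths (v ∷ snakeUp k L)) (∣m+n-m+o∣≡∣n-o∣ (k * y) u v) ⟩
      ∣ u - v ∣ ∷ replicate k y ++ edgeLengths (v ∷ snakeUp k L)
        ↭⟨ prep _ (++⁺ˡ (replicate k y) (edgeLengths-snakeUp k v L)) ⟩
      ∣ u - v ∣ ∷ replicate k y ++ edgeLengths (v ∷ L) ++ replicate (length L * k) y
        ↭⟨ prep _ (replicate-shift y k (length L * k) (edgeLengths (v ∷ L))) ⟩
      ∣ u - v ∣ ∷ edgeLengths (v ∷ L) ++ replicate (k + length L * k) y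
        ∎
      where open PermutationReasoning

  edgeLengths-snake : ∀ k P → edgeLengths (snakeUp k P) ↭ edgeLengths P ++ replicate (length P * k) y
  edgeLengths-snake k []      = ↭-refl
  -- Start the walk at v itself, so that both sides begin with the zero edge ∣ v - v ∣.
  edgeLengths-snake k (v ∷ L) = drop-∷ (edgeLengths-snakeUp k v (v ∷ L))

  realizationOn-snake : ∀ {s M P} k → RealizationOn s y M P →
    RealizationOn s (suc k * y) (M ++ replicate (k * y) y) (snakeUp k P)
  realizationOn-snake {s} {M} {P} k (vertices , lengths) =
    ↭-trans (snakeUp↭columns k P) (↭-trans (concatMap-↭ (λ v → ascending v k) vertices) (columns-interval k s)) ,
    (begin
      edgeLengths (snakeUp k P)                    ↭⟨ edgeLengths-snake k P ⟩
      edgeLengths P ++ replicate (length P * k) y  ≡⟨ cong (λ m → edgeLengths P ++ replicate m y) |P|*k≡k*y ⟩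
      edgeLengths P ++ replicate (k * y) y         ↭⟨ ++⁺ʳ (replicate (k * y) y) lengths ⟩
      M ++ replicate (k * y) y                     ∎)
    where
    open PermutationReasoning
    |P|*k≡k*y : length P * k ≡ k * y
    |P|*k≡k*y = trans (cong (_* k) (trans (↭-length vertices) (length-interval s y))) (*-comm y k)

open Boustrophedon using (realizationOn-snake)

standard-++-replicate : ∀ {M y c} → suc (length M) ≡ y → (∃[ k ] (c ≡ k * y ⊎ c ≡ k * y + 1)) →
  HasStandardLinearRealization M → HasStandardLinearRealization (M ++ replicate c y)
standard-++-replicate refl (k , inj₁ refl) (t , realization) =
  realizationOn⇒standard (realizationOn-snake _ k (standard⇒realizationOn realization))
standard-++-replicate {M} {y} refl (k , inj₂ refl) (t , realization) =
  realizationOn⇒standard (realizationOn-resp-↭ move-y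
    (realizationOn-prepend (realizationOn-snake y k (realizationOn-reflect (standard⇒realizationOn realization)))))
  where
  open PermutationReasoning
  move-y : y ∷ M ++ replicate (k * y) y ↭ M ++ replicate (k * y + 1) y
  move-y = begin
    y ∷ M ++ replicate (k * y) y  ↭⟨ shift y M (replicate (k * y) y) ⟨
    M ++ replicate (1 + k * y) y  ≡⟨ cong (λ m → M ++ replicate m y) (+-comm 1 (k * y)) ⟩
    M ++ replicate (k * y + 1) y  ∎

theorem3p1 : (x y a b c : ℕ) → 1 < x → x < y →
    (∃[ k ] (c ≡ k * y ⊎ c ≡ k * y + 1)) →
    a + b + 1 ≡ y →
    (w : ℕ) → IsOmega x b w → w ≤ a →
    HasStandardLinearRealization (M₃ a x b y c)
theorem3p1 x .(a + b + 1) a b c _ _ c-mod-y refl w (realizable , _) w≤a =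
  subst HasStandardLinearRealization (++-assoc (replicate a 1) (replicate b x) (replicate c (a + b + 1)))
    (standard-++-replicate 1+|M₂|≡y c-mod-y (standard-more-ones (≤⇒≤′ w≤a) realizable))
  where
  1+|M₂|≡y : suc (length (M₂ a x b)) ≡ a + b + 1
  1+|M₂|≡y = trans (cong suc (trans (length-++ (replicate a 1))
                                    (cong₂ _+_ (length-replicate a) (length-replicate b))))
                   (+-comm 1 (a + b))
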